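{- Let $X=\{1,\ldots,n\}$, $k\in\{1,\ldots,n\}$, and let $\succeq$ be a binary relation on $\mathcal{F}=\mathbb{R}^X$ satisfying axioms A1, A2, A4, A5 and A6; let $\mu$ be a capacity such that $\mathcal{C}_\mu$ represents $\succeq$. Then $\succeq$ satisfies axiom A9(k) with respect to $\mathcal{H}=\mathcal{C}_\mu$ if and only if for all distinct $i_1,\ldots,i_k\in X$ and every $C\subseteq X$ with $i_1,\ldots,i_k\in C$, $$\sum_{B\subseteq\{i_1,\ldots,i_k\}}(-1)^{|B|}\mu(C\setminus B)=\sum_{B\subseteq\{i_1,\ldots,i_k\}}(-1)^{k-|B|}\mu(B).$$
   Context: Acts are $f\in\mathcal{F}=\mathbb{R}^X$; $\mathcal{F}_M$ is the set of nondecreasing acts. A capacity is $\mu:\mathcal{P}(X)\to[0,1]$ with $\mu(\emptyset)=0$, $\mu(X)=1$, monotone for inclusion. For $f$, $f_{(1)}\leq\cdots\leq f_{(n)}$ are its values in nondecreasing order; $\mathcal{C}_\mu(f)=\sum_{i=1}^n (f_{(i)}-f_{(i-1)})\mu(\{(i),\ldots,(n)\})$ with $f_{(0)}:=0$. $V$ represents $\succeq$ if $f\succeq g\iff V(f)\geq V(g)$; $\succ,\sim$ asymmetric/symmetric parts. $f,g$ comonotone: $(f_i-f_j)(g_i-g_j)\geq0$ for all $i,j$. For $f$, $t>0$, $B\subseteq X$: $f^B_l=f_l+t$ if $l\in B$, $f^B_l=f_l$ otherwise. Axioms: (A1) complete, reflexive, transitive. (A2) for every $f$, $\{g:g\succ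 f\}$ and $\{g:f\succ g\}$ are open in $\mathbb{R}^n$. (A4) for all $f,g,h\in\mathcal{F}_M$: $f\succeq g\iff f+h\succeq g+h$. (A5) if $f_i\geq g_i$ for all $i$ then $f\succeq g$. (A6) there exist $f,g$ with $f\succ g$. (A9(k)) with respect to a functional $\mathcal{H}$ representing $\succeq$: for all distinct $i_1,\ldots,i_k\in X$, all $f,g$ with $f_{i_1}=\cdots=f_{i_k}$ and $g_{i_1}=\cdots=g_{i_k}$, and all $t>0$ such that $f^B$ is comonotone with $f$ and $g^B$ with $g$ for every $B\subseteq\{i_1,\ldots,i_k\}$, one has $\sum_{B\subseteq\{i_1,\ldots,i_k\}}(-1)^{|B|}\mathcal{H}(f^B)=\sum_{B\subseteq\{i_1,\ldots,i_k\}}(-1)^{|B|}\mathcal{H}(g^B)$. -}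

module Defs where

open import Level using (0ℓ)
open import Data.Nat as ℕ using (ℕ; zero; suc)
open import Data.Fin as Fin using (Fin)
open import Data.Bool using (Bool; true; false; if_then_else_)
open import Data.List as List using (List; []; _∷_)
open import Data.Vec as Vec using (Vec; []; _∷_)
open import Data.Fin.Subset as Sub using (Subset; inside; outside; ⁅_⁆; _∪_; _─_; ∣_∣)
open import Data.Product using (Σ; ∃; _×_; _,_)
open import Data.Sum using (_⊎_)
open import Relation.Nullary using (¬_; does)
open import Relation.Binary.PropositionalEquality using (_≡_; _≢_)
open import Algebra.Structures using (IsCommutativeRing)
open import Relation.Binary.Structures using (IsDecTotalOrder)
open import Function.Bundles using (_⇔_)
open import Function.Definitions using (Injective)

-- The real numbers, axiomatised as a complete ordered field
-- (any model is isomorphic to ℝ).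

record RealField : Set₁ where
  infixl 6 _+_ _-_
  infixl 7 _*_
  infix 4 _≤_ _<_
  field
    Carrier : Set
    _+_ _*_ : Carrier → Carrier → Carrier
    -_      : Carrier → Carrier
    0ℝ 1ℝ   : Carrier
    _≤_     : Carrier → Carrier → Set
    isCommutativeRing : IsCommutativeRing _≡_ _+_ _*_ -_ 0ℝ 1ℝ
    isDecTotalOrder   : IsDecTotalOrder _≡_ _≤_
    0≢1     : 0ℝ ≢ 1ℝ
    inverse : ∀ x → x ≢ 0ℝ → ∃ λ y → x * y ≡ 1ℝ
    +-mono  : ∀ x y z → x ≤ y → x + z ≤ y + z
    *-pos   : ∀ x y → 0ℝ ≤ x → 0ℝ ≤ y → 0ℝ ≤ x * y
    complete : (S : Carrier → Set) → (∃ λ x → S x) →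
               (∃ λ b → ∀ x → S x → x ≤ b) →
               ∃ λ s → (∀ x → S x → x ≤ s) ×
                       (∀ b → (∀ x → S x → x ≤ b) → s ≤ b)

  _-_ : Carrier → Carrier → Carrier
  x - y = x + (- y)

  _<_ : Carrier → Carrier → Set
  x < y = x ≤ y × x ≢ y

  _≤?_ = IsDecTotalOrder._≤?_ isDecTotalOrder

module _ (R : RealField) where
  open RealField R

  Act : ℕ → Set
  Act n = Fin n → Carrier

  _⊕_ : ∀ {n} → Act n → Act n → Act n
  (f ⊕ g) i = f i + g i

  Nondecreasing : ∀ {n} → Act n → Set
  Nondecreasing f = ∀ i j → i Fin.≤ j → f i ≤ f j

  Comonotone : ∀ {n} → Act n → Act n → Set
  Comonotone f g = ∀ i j → 0ℝ ≤ (f i - f j) * (g i - g j)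

  shift : ∀ {n} → Act n → Carrier → Subset n → Act n
  shift f t B l = if Vec.lookup B l then f l + t else f l

  Capacity : ℕ → Set
  Capacity n = Subset n → Carrier

  IsCapacity : ∀ {n} → Capacity n → Set
  IsCapacity {n} μ = (μ Sub.⊥ ≡ 0ℝ) × (μ Sub.⊤ ≡ 1ℝ) ×
                     (∀ A B → A Sub.⊆ B → μ A ≤ μ B)

  insert : ∀ {n} → Act n → Fin n → List (Fin n) → List (Fin n)
  insert f x [] = x ∷ []
  insert f x (y ∷ ys) = if does (f x ≤? f y) then x ∷ y ∷ ys else y ∷ insert f x ys

  sortBy : ∀ {n} → Act n → List (Fin n) → List (Fin n)
  sortBy f = List.foldr (insert f) []

  toSubset : ∀ {n} → List (Fin n) → Subset n
  toSubset = List.foldr (λ x s → ⁅ x ⁆ ∪ s) Sub.⊥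

  -- Σ_i (f_(i) - f_(i-1)) μ({(i),…,(n)}) over the sorted list, prev = f_(i-1)
  choquetAux : ∀ {n} → Capacity n → Act n → Carrier → List (Fin n) → Carrier
  choquetAux μ f prev [] = 0ℝ
  choquetAux μ f prev (x ∷ xs) = (f x - prev) * μ (toSubset (x ∷ xs)) + choquetAux μ f (f x) xs

  Choquet : ∀ {n} → Capacity n → Act n → Carrier
  Choquet {n} μ f = choquetAux μ f 0ℝ (sortBy f (List.allFin n))

  Pref : ℕ → Set₁
  Pref n = Act n → Act n → Set

  Strict : ∀ {n} → Pref n → Pref n
  Strict _≽_ f g = (f ≽ g) × ¬ (g ≽ f)

  -- open in ℝⁿ (sup-norm balls generate the usual topology)
  IsOpen : ∀ {n} → (Act n → Set) → Set
  IsOpen A = ∀ f → A f → ∃ λ ε → (0ℝ < ε) ×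
             (∀ g → (∀ i → (g i - f i < ε) × (f i - g i < ε)) → A g)

  A1 : ∀ {n} → Pref n → Set
  A1 _≽_ = (∀ f g → (f ≽ g) ⊎ (g ≽ f)) × (∀ f → f ≽ f) ×
           (∀ f g h → f ≽ g → g ≽ h → f ≽ h)

  A2 : ∀ {n} → Pref n → Set
  A2 _≽_ = ∀ f → IsOpen (λ g → Strict _≽_ g f) × IsOpen (λ g → Strict _≽_ f g)

  A4 : ∀ {n} → Pref n → Set
  A4 _≽_ = ∀ f g h → Nondecreasing f → Nondecreasing g → Nondecreasing h →
           (f ≽ g) ⇔ ((f ⊕ h) ≽ (g ⊕ h))

  A5 : ∀ {n} → Pref n → Set
  A5 _≽_ = ∀ f g → (∀ i → g i ≤ f i) → f ≽ g

  A6 : ∀ {n} → Pref n → Set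
  A6 _≽_ = ∃ λ f → ∃ λ g → Strict _≽_ f g

  Represents : ∀ {n} → (Act n → Carrier) → Pref n → Set
  Represents V _≽_ = ∀ f g → (f ≽ g) ⇔ (V g ≤ V f)

  sumSubsets : (k : ℕ) → (Subset k → Carrier) → Carrier
  sumSubsets zero g = g []
  sumSubsets (suc k) g = sumSubsets k (λ s → g (outside ∷ s)) + sumSubsets k (λ s → g (inside ∷ s))

  negOnePow : ℕ → Carrier
  negOnePow zero = 1ℝ
  negOnePow (suc m) = - negOnePow m

  image : ∀ {k n} → (Fin k → Fin n) → Subset k → Subset n
  image {k} ι b = List.foldr (λ j s → if Vec.lookup b j then ⁅ ι j ⁆ ∪ s else s)
                             Sub.⊥ (List.allFin k)

  -- Axiom A9(k) w.r.t. H, with i_1,…,i_k given by an injection ι : Fin k → Fin n;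
  -- subsets B ⊆ {i_1,…,i_k} are image ι b for b ⊆ Fin k (|B| = ∣ b ∣ by injectivity).
  A9 : ∀ {n} → (k : ℕ) → (Act n → Carrier) → Set
  A9 {n} k H = ∀ (ι : Fin k → Fin n) → Injective _≡_ _≡_ ι →
    ∀ f g → (∀ a b → f (ι a) ≡ f (ι b)) → (∀ a b → g (ι a) ≡ g (ι b)) →
    ∀ t → 0ℝ < t →
    (∀ b → Comonotone (shift f t (image ι b)) f × Comonotone (shift g t (image ι b)) g) →
    sumSubsets k (λ b → negOnePow ∣ b ∣ * H (shift f t (image ι b)))
      ≡ sumSubsets k (λ b → negOnePow ∣ b ∣ * H (shift g t (image ι b)))

  CapacityCondition : ∀ {n} → (k : ℕ) → Capacity n → Set
  CapacityCondition {n} k μ = ∀ (ι : Fin k → Fin n) → Injective _≡_ _≡_ ι →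
    ∀ (C : Subset n) → (∀ a → ι a Sub.∈ C) →
    sumSubsets k (λ b → negOnePow ∣ b ∣ * μ (C ─ image ι b))
      ≡ sumSubsets k (λ b → negOnePow (k ℕ.∸ ∣ b ∣) * μ (image ι b))

module Submission where

-- Write C_μ(f) = Σᵢ (wᵢ - wᵢ₋₁) μ({wᵢ ≤ f}) over any ascending list of
-- thresholds containing the values of f (LevelSets).  If f equals c on the
-- directions and no value of f lies strictly between c and c + t, then the
-- shifted acts f^B have the level sets of f except on (c, c + t], where they
-- are {c + t ≤ f} ∪ B (Shifts).  Hence the alternating sum in A9 equals
-- t·Δ({c + t ≤ f}) with Δ(X) = Σ_B (-1)^|B| μ(X ∪ B) (AlternatingShifts).
-- Comonotonicity of f^B with f is exactly this gap condition, so A9 says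
-- that Δ is constant on sets avoiding the directions (test it on indicator
-- acts), and reindexing B ↦ ∁B turns that into the capacity condition.

open import Defs
open import Data.Nat as ℕ using (ℕ; zero; suc)
import Data.Nat.Properties as ℕP
open import Data.Fin as Fin using (Fin)
open import Data.Bool using (Bool; true; false; if_then_else_; _∨_; _∧_; not)
import Data.Bool.Properties as BoolP
open import Data.List as List using (List; []; _∷_; _++_)
open import Data.List.Relation.Unary.Any using (here; there)
open import Data.List.Relation.Unary.Any.Properties using (¬Any[])
open import Data.List.Relation.Unary.All as All using (All; []; _∷_)
open import Data.List.Relation.Unary.AllPairs using (AllPairs; []; _∷_)
open import Data.List.Relation.Unary.Linked.Properties using (Linked⇒AllPairs; AllPairs⇒Linked)
open import Data.List.Membership.Propositional using (_∈_)
open import Data.List.Membership.Propositional.Properties using (∈-map⁺; ∈-allFin)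
open import Data.List.Relation.Binary.Permutation.Propositional as Perm using (_↭_; ↭-sym)
open import Data.List.Relation.Binary.Permutation.Propositional.Properties using (∈-resp-↭; ++-comm)
open import Data.List.Relation.Binary.Pointwise using (Pointwise-≡⇒≡)
open import Data.Vec as Vec using (Vec; []; _∷_)
import Data.Vec.Properties as VecP
open import Data.Fin.Subset as Sub using (Subset; inside; outside; ⁅_⁆; _∪_; _─_; ∣_∣)
import Data.Fin.Subset.Properties as SubP
open import Data.Product using (∃; _×_; _,_; proj₁; proj₂)
open import Data.Sum using (_⊎_; inj₁; inj₂)
open import Data.Empty using (⊥-elim)
open import Relation.Nullary using (¬_; Dec; does; yes; no)
open import Relation.Nullary.Decidable using (dec-true; dec-false)
open import Relation.Binary.PropositionalEquality
open import Relation.Binary.Bundles using (DecTotalOrder)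
open import Algebra.Bundles using (CommutativeRing)
import Algebra.Properties.Group as GroupProperties
import Algebra.Properties.AbelianGroup as AbelianGroupProperties
import Algebra.Properties.Ring as RingProperties
import Algebra.Properties.CommutativeSemigroup as CommutativeSemigroupProperties
import Relation.Binary.Properties.DecTotalOrder as DecTotalOrderProperties
open import Function.Bundles using (_⇔_; mk⇔)
open import Function.Definitions using (Injective)

module FieldFacts (R : RealField) where
  open RealField R

  commutativeRing : CommutativeRing _ _
  commutativeRing = record { isCommutativeRing = isCommutativeRing }

  decTotalOrder : DecTotalOrder _ _ _
  decTotalOrder = record { isDecTotalOrder = isDecTotalOrder }

  open CommutativeRing commutativeRing public
    using ( +-assoc; +-comm; *-assoc; *-comm; +-identityˡ; *-identityˡ
          ; distribˡ; distribʳ; -‿inverseʳ; zeroˡ; zeroʳ)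
  open CommutativeRing commutativeRing using (+-abelianGroup; +-group; ring; *-commutativeSemigroup; +-commutativeSemigroup)
  open GroupProperties +-group public using (//-rightDividesˡ; //-rightDividesʳ; ⁻¹-involutive; x∙y⁻¹≈ε⇒x≈y)
  open AbelianGroupProperties +-abelianGroup public using (⁻¹-∙-comm)
  open RingProperties ring public
    using (-‿distribˡ-*; -‿distribʳ-*)
  open CommutativeSemigroupProperties *-commutativeSemigroup public
    using (xy∙z≈y∙xz; x∙yz≈y∙xz)
  open CommutativeSemigroupProperties +-commutativeSemigroup public
    using (interchange)
  open DecTotalOrder decTotalOrder public
    using () renaming (refl to ≤-refl; total to ≤-total; trans to ≤-trans; antisym to ≤-antisym; reflexive to ≤-reflexive)
  open DecTotalOrderProperties decTotalOrder public using (≰⇒>)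
  open ≡-Reasoning

  sub-add-cancel : ∀ x y → (y - x) + x ≡ y
  sub-add-cancel = //-rightDividesˡ

  add-sub-cancelˡ : ∀ x t → (x + t) - x ≡ t
  add-sub-cancelˡ x t = trans (cong (_- x) (+-comm x t)) (//-rightDividesʳ x t)

  sub-telescope : ∀ p w d → (w - p) + (d - w) ≡ d - p
  sub-telescope p w d = begin
    (w - p) + (d - w)   ≡⟨ +-comm (w - p) (d - w) ⟩
    (d - w) + (w - p)   ≡⟨ +-assoc (d - w) w (- p) ⟨
    ((d - w) + w) - p   ≡⟨ cong (_- p) (sub-add-cancel w d) ⟩
    d - p               ∎

  neg-*-neg : ∀ x y → - x * - y ≡ x * y
  neg-*-neg x y = begin
    - x * - y       ≡⟨ -‿distribˡ-* x (- y) ⟨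
    - (x * - y)     ≡⟨ cong -_ (-‿distribʳ-* x y) ⟨
    - - (x * y)     ≡⟨ ⁻¹-involutive (x * y) ⟩
    x * y           ∎

  equal-sub-* : ∀ {a b} m → a ≡ b → (a - b) * m ≡ 0ℝ
  equal-sub-* {a} m refl = trans (cong (_* m) (-‿inverseʳ a)) (zeroˡ m)

  sub-nonneg : ∀ {x y} → x ≤ y → 0ℝ ≤ y - x
  sub-nonneg {x} {y} x≤y = subst (_≤ y - x) (-‿inverseʳ x) (+-mono x y (- x) x≤y)

  sub-nonpos : ∀ {x y} → x ≤ y → x - y ≤ 0ℝ
  sub-nonpos {x} {y} x≤y = subst (x - y ≤_) (-‿inverseʳ y) (+-mono x y (- y) x≤y)

  nonneg-sub : ∀ {x y} → 0ℝ ≤ y - x → x ≤ y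
  nonneg-sub {x} {y} h = subst₂ _≤_ (+-identityˡ x) (sub-add-cancel x y) (+-mono 0ℝ (y - x) x h)

  neg-nonneg : ∀ {x} → x ≤ 0ℝ → 0ℝ ≤ - x
  neg-nonneg {x} x≤0 = subst (0ℝ ≤_) (+-identityˡ (- x)) (sub-nonneg x≤0)

  nonneg-neg : ∀ {x} → 0ℝ ≤ - x → x ≤ 0ℝ
  nonneg-neg {x} h = nonneg-sub (subst (0ℝ ≤_) (sym (+-identityˡ (- x))) h)

  *-nonpos : ∀ {x y} → x ≤ 0ℝ → y ≤ 0ℝ → 0ℝ ≤ x * y
  *-nonpos {x} {y} x≤0 y≤0 = subst (0ℝ ≤_) (neg-*-neg x y) (*-pos _ _ (neg-nonneg x≤0) (neg-nonneg y≤0))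

  sub-pos : ∀ {x y} → x < y → 0ℝ < y - x
  sub-pos {x} {y} (x≤y , x≢y) = sub-nonneg x≤y , λ 0≡y-x → x≢y (sym (x∙y⁻¹≈ε⇒x≈y y x (sym 0≡y-x)))

  sub-neg : ∀ {x y} → x < y → x - y < 0ℝ
  sub-neg {x} {y} (x≤y , x≢y) = sub-nonpos x≤y , λ x-y≡0 → x≢y (x∙y⁻¹≈ε⇒x≈y x y x-y≡0)

  same-sign : ∀ {u v} → (0ℝ ≤ u × 0ℝ ≤ v) ⊎ (u ≤ 0ℝ × v ≤ 0ℝ) → 0ℝ ≤ u * v
  same-sign (inj₁ (0≤u , 0≤v)) = *-pos _ _ 0≤u 0≤v
  same-sign (inj₂ (u≤0 , v≤0)) = *-nonpos u≤0 v≤0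

  square-nonneg : ∀ x → 0ℝ ≤ x * x
  square-nonneg x with ≤-total 0ℝ x
  ... | inj₁ 0≤x = *-pos x x 0≤x 0≤x
  ... | inj₂ x≤0 = *-nonpos x≤0 x≤0

  0<1 : 0ℝ < 1ℝ
  0<1 = subst (0ℝ ≤_) (*-identityˡ 1ℝ) (square-nonneg 1ℝ) , 0≢1

  no-zero-divisors : ∀ x y → x * y ≡ 0ℝ → x ≢ 0ℝ → y ≡ 0ℝ
  no-zero-divisors x y xy≡0 x≢0 with inverse x x≢0
  ... | x⁻¹ , xx⁻¹≡1 = begin
    y                 ≡⟨ *-identityˡ y ⟨
    1ℝ * y            ≡⟨ cong (_* y) xx⁻¹≡1 ⟨
    (x * x⁻¹) * y     ≡⟨ xy∙z≈y∙xz x x⁻¹ y ⟩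
    x⁻¹ * (x * y)     ≡⟨ cong (x⁻¹ *_) xy≡0 ⟩
    x⁻¹ * 0ℝ          ≡⟨ zeroʳ x⁻¹ ⟩
    0ℝ                ∎

  pos-*-neg : ∀ {x y} → 0ℝ < x → y < 0ℝ → ¬ (0ℝ ≤ x * y)
  pos-*-neg {x} {y} (0≤x , 0≢x) (y≤0 , y≢0) 0≤xy = y≢0 (no-zero-divisors x y xy≡0 (λ x≡0 → 0≢x (sym x≡0)))
    where
    xy≤0 : x * y ≤ 0ℝ
    xy≤0 = nonneg-neg (subst (0ℝ ≤_) (sym (-‿distribʳ-* x y)) (*-pos x (- y) 0≤x (neg-nonneg y≤0)))
    xy≡0 : x * y ≡ 0ℝ
    xy≡0 = ≤-antisym xy≤0 0≤xy

  x≤x+t : ∀ x {t} → 0ℝ ≤ t → x ≤ x + t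
  x≤x+t x {t} 0≤t = subst₂ _≤_ (+-identityˡ x) (+-comm t x) (+-mono 0ℝ t x 0≤t)

  x+t≰x : ∀ x {t} → 0ℝ < t → ¬ (x + t ≤ x)
  x+t≰x x {t} (0≤t , 0≢t) x+t≤x = 0≢t (≤-antisym 0≤t t≤0)
    where
    t≤0 : t ≤ 0ℝ
    t≤0 = subst₂ _≤_ (add-sub-cancelˡ x t) (-‿inverseʳ x) (+-mono (x + t) x (- x) x+t≤x)

module SubsetSums (R : RealField) where
  open RealField R
  open FieldFacts R
  open ≡-Reasoning

  sum-cong : ∀ k {g h : Subset k → Carrier} → (∀ b → g b ≡ h b) →
             sumSubsets R k g ≡ sumSubsets R k h
  sum-cong zero    g≡h = g≡h []
  sum-cong (suc k) g≡h = cong₂ _+_ (sum-cong k (λ b → g≡h (outside ∷ b)))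
                                   (sum-cong k (λ b → g≡h (inside ∷ b)))

  sum-+ : ∀ k (g h : Subset k → Carrier) →
          sumSubsets R k (λ b → g b + h b) ≡ sumSubsets R k g + sumSubsets R k h
  sum-+ zero    g h = refl
  sum-+ (suc k) g h = trans (cong₂ _+_ (sum-+ k _ _) (sum-+ k _ _)) (interchange _ _ _ _)

  sum-* : ∀ k x (g : Subset k → Carrier) →
          sumSubsets R k (λ b → x * g b) ≡ x * sumSubsets R k g
  sum-* zero    x g = refl
  sum-* (suc k) x g = trans (cong₂ _+_ (sum-* k x _) (sum-* k x _)) (sym (distribˡ x _ _))

  sum-0 : ∀ k → sumSubsets R k (λ _ → 0ℝ) ≡ 0ℝ
  sum-0 zero    = refl
  sum-0 (suc k) = trans (cong₂ _+_ (sum-0 k) (sum-0 k)) (+-identityˡ 0ℝ)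

  sum-neg : ∀ k (g : Subset k → Carrier) → sumSubsets R k (λ b → - g b) ≡ - sumSubsets R k g
  sum-neg zero    g = refl
  sum-neg (suc k) g = trans (cong₂ _+_ (sum-neg k _) (sum-neg k _)) (⁻¹-∙-comm _ _)

  sum-∁ : ∀ k (g : Subset k → Carrier) → sumSubsets R k (λ b → g (Sub.∁ b)) ≡ sumSubsets R k g
  sum-∁ zero    g = refl
  sum-∁ (suc k) g = trans (cong₂ _+_ (sum-∁ k (λ b → g (inside ∷ b))) (sum-∁ k (λ b → g (outside ∷ b))))
                          (+-comm _ _)

  -- adding an element flips the sign (-1)^|b|, so the two halves cancel
  alternating-const : ∀ k M → sumSubsets R (suc k) (λ b → negOnePow R ∣ b ∣ * M) ≡ 0ℝ
  alternating-const k M = begin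
    S + sumSubsets R k (λ b → - negOnePow R ∣ b ∣ * M)
      ≡⟨ cong (S +_) (sum-cong k (λ b → sym (-‿distribˡ-* (negOnePow R ∣ b ∣) M))) ⟩
    S + sumSubsets R k (λ b → - (negOnePow R ∣ b ∣ * M))
      ≡⟨ cong (S +_) (sum-neg k (λ b → negOnePow R ∣ b ∣ * M)) ⟩
    S - S
      ≡⟨ -‿inverseʳ S ⟩
    0ℝ ∎
    where
    S = sumSubsets R k (λ b → negOnePow R ∣ b ∣ * M)

  negOnePow-+ : ∀ a b → negOnePow R (a ℕ.+ b) ≡ negOnePow R a * negOnePow R b
  negOnePow-+ zero    b = sym (*-identityˡ _)
  negOnePow-+ (suc a) b = trans (cong -_ (negOnePow-+ a b)) (-‿distribˡ-* _ _)

  negOnePow-square : ∀ a → negOnePow R a * negOnePow R a ≡ 1ℝ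
  negOnePow-square zero    = *-identityˡ 1ℝ
  negOnePow-square (suc a) = trans (neg-*-neg _ _) (negOnePow-square a)

  negOnePow-cancel : ∀ m {x y} → negOnePow R m * x ≡ negOnePow R m * y → x ≡ y
  negOnePow-cancel m {x} {y} εx≡εy = begin
    x                 ≡⟨ unscale x ⟨
    ε * (ε * x)       ≡⟨ cong (ε *_) εx≡εy ⟩
    ε * (ε * y)       ≡⟨ unscale y ⟩
    y                 ∎
    where
    ε = negOnePow R m
    unscale : ∀ z → ε * (ε * z) ≡ z
    unscale z = trans (sym (*-assoc ε ε z)) (trans (cong (_* z) (negOnePow-square m)) (*-identityˡ z))

  -- |b| + |∁ b| = k, hence (-1)^{|∁ b|} = (-1)^k (-1)^{|b|}
  negOnePow-∁ : ∀ {k} (b : Subset k) → negOnePow R ∣ Sub.∁ b ∣ ≡ negOnePow R k * negOnePow R ∣ b ∣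
  negOnePow-∁ {k} b = begin
    ε∁                       ≡⟨ *-identityˡ ε∁ ⟨
    1ℝ * ε∁                  ≡⟨ cong (_* ε∁) (negOnePow-square ∣ b ∣) ⟨
    (ε * ε) * ε∁             ≡⟨ *-assoc ε ε ε∁ ⟩
    ε * (ε * ε∁)             ≡⟨ cong (ε *_) (negOnePow-+ ∣ b ∣ ∣ Sub.∁ b ∣) ⟨
    ε * negOnePow R (∣ b ∣ ℕ.+ ∣ Sub.∁ b ∣) ≡⟨ cong (λ m → ε * negOnePow R m) card-split ⟩
    ε * negOnePow R k        ≡⟨ *-comm ε (negOnePow R k) ⟩
    negOnePow R k * ε        ∎
    where
    ε  = negOnePow R ∣ b ∣
    ε∁ = negOnePow R ∣ Sub.∁ b ∣
    card-split : ∣ b ∣ ℕ.+ ∣ Sub.∁ b ∣ ≡ k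
    card-split = trans (cong (∣ b ∣ ℕ.+_) (SubP.∣∁p∣≡n∸∣p∣ b)) (ℕP.m+[n∸m]≡n (SubP.∣p∣≤n b))

module SortedValues (R : RealField) where
  open RealField R
  open FieldFacts R
  open import Data.List.Sort.InsertionSort.Base decTotalOrder public
    renaming (insert to insertValue; sort to sortValues)
  open import Data.List.Sort.InsertionSort.Properties decTotalOrder
    using (insert-↗; sort-↗; insert-swap; insert-↭; sort-↭)

  Ascending : List Carrier → Set
  Ascending = AllPairs _≤_

  sort-ascending : ∀ L → Ascending (sortValues L)
  sort-ascending L = Linked⇒AllPairs ≤-trans (sort-↗ L)

  insertAll : List Carrier → List Carrier → List Carrier
  insertAll ws T = List.foldr insertValue T ws

  insertAll-ascending : ∀ ws {T} → Ascending T → Ascending (insertAll ws T)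
  insertAll-ascending []       asc = asc
  insertAll-ascending (w ∷ ws) asc =
    Linked⇒AllPairs ≤-trans (insert-↗ w (AllPairs⇒Linked (insertAll-ascending ws asc)))

  ∈-insertAll : ∀ {x} ws T → x ∈ T → x ∈ insertAll ws T
  ∈-insertAll []       T x∈T = x∈T
  ∈-insertAll (w ∷ ws) T x∈T = ∈-resp-↭ (↭-sym (insert-↭ w _)) (there (∈-insertAll ws T x∈T))

  ∈-sort : ∀ {x} L → x ∈ L → x ∈ sortValues L
  ∈-sort L = ∈-resp-↭ (↭-sym (sort-↭ L))

  sort-++ : ∀ xs ys → sortValues (xs ++ ys) ≡ insertAll xs (sortValues ys)
  sort-++ []       ys = refl
  sort-++ (x ∷ xs) ys = cong (insertValue x) (sort-++ xs ys)

  sort-perm-invariant : ∀ {xs ys} → xs ↭ ys → sortValues xs ≡ sortValues ys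
  sort-perm-invariant Perm.refl          = refl
  sort-perm-invariant (Perm.prep x p)    = cong (insertValue x) (sort-perm-invariant p)
  sort-perm-invariant (Perm.swap {ys = ys} x y p) =
    trans (cong (λ zs → insertValue x (insertValue y zs)) (sort-perm-invariant p))
          (Pointwise-≡⇒≡ (insert-swap x y (sortValues ys)))
  sort-perm-invariant (Perm.trans p q)   = trans (sort-perm-invariant p) (sort-perm-invariant q)

  head-least : ∀ {x w ws} → Ascending (w ∷ ws) → x ∈ (w ∷ ws) → w ≤ x
  head-least _            (here refl) = ≤-refl
  head-least (w≤ws ∷ _)   (there x∈ws) = All.lookup w≤ws x∈ws

-- The Choquet integral is such a sum with Φ(w) = μ({w ≤ f}).
module ThresholdSums (R : RealField) where
  open RealField R
  open FieldFacts R
  open SubsetSums R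
  open SortedValues R using (Ascending; head-least)
  open ≡-Reasoning

  thresholdSum : (Carrier → Carrier) → Carrier → List Carrier → Carrier
  thresholdSum Φ p []      = 0ℝ
  thresholdSum Φ p (w ∷ W) = (w - p) * Φ w + thresholdSum Φ w W

  thresholdSum-linear : ∀ k (e : Subset k → Carrier) (Φ : Subset k → Carrier → Carrier) p W →
    sumSubsets R k (λ b → e b * thresholdSum (Φ b) p W)
      ≡ thresholdSum (λ w → sumSubsets R k (λ b → e b * Φ b w)) p W
  thresholdSum-linear k e Φ p [] = trans (sum-cong k (λ b → zeroʳ (e b))) (sum-0 k)
  thresholdSum-linear k e Φ p (w ∷ W) = begin
    sumSubsets R k (λ b → e b * ((w - p) * Φ b w + thresholdSum (Φ b) w W))
      ≡⟨ sum-cong k distribute ⟩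
    sumSubsets R k (λ b → (w - p) * (e b * Φ b w) + e b * thresholdSum (Φ b) w W)
      ≡⟨ sum-+ k _ _ ⟩
    sumSubsets R k (λ b → (w - p) * (e b * Φ b w)) + sumSubsets R k (λ b → e b * thresholdSum (Φ b) w W)
      ≡⟨ cong₂ _+_ (sum-* k (w - p) _) (thresholdSum-linear k e Φ w W) ⟩
    (w - p) * sumSubsets R k (λ b → e b * Φ b w) + thresholdSum (λ w → sumSubsets R k (λ b → e b * Φ b w)) w W ∎
    where
    distribute : ∀ b → e b * ((w - p) * Φ b w + thresholdSum (Φ b) w W)
                         ≡ (w - p) * (e b * Φ b w) + e b * thresholdSum (Φ b) w W
    distribute b = trans (distribˡ (e b) ((w - p) * Φ b w) (thresholdSum (Φ b) w W))
                         (cong (_+ e b * thresholdSum (Φ b) w W) (x∙yz≈y∙xz (e b) (w - p) (Φ b w)))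

  module Box (Φ : Carrier → Carrier) {c d : Carrier} (S : Carrier) (c≤d : c ≤ d)
             (below : ∀ w → w ≤ c → Φ w ≡ 0ℝ)
             (above : ∀ w → ¬ (w ≤ d) → Φ w ≡ 0ℝ)
             (within : ∀ w → ¬ (w ≤ c) → w ≤ d → Φ w ≡ S) where

    sum-above : ∀ p W → All (λ w → ¬ (w ≤ d)) W → thresholdSum Φ p W ≡ 0ℝ
    sum-above p []      []          = refl
    sum-above p (w ∷ W) (w≰d ∷ W≰d) =
      trans (cong₂ _+_ (trans (cong ((w - p) *_) (above w w≰d)) (zeroʳ _)) (sum-above w W W≰d))
            (+-identityˡ 0ℝ)

    sum-from : ∀ p W → c ≤ p → p ≤ d → Ascending W → All (p ≤_) W → d ∈ W ⊎ p ≡ d →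
               thresholdSum Φ p W ≡ (d - p) * S
    sum-from p []      _   _   _ _ (inj₂ p≡d) = sym (equal-sub-* S (sym p≡d))
    sum-from p (w ∷ W) c≤p p≤d (w≤W ∷ asc) (p≤w ∷ _) reach with w ≤? d
    ... | yes w≤d = begin
      (w - p) * Φ w + thresholdSum Φ w W  ≡⟨ cong₂ _+_ first-step rest ⟩
      (w - p) * S + (d - w) * S           ≡⟨ distribʳ S (w - p) (d - w) ⟨
      ((w - p) + (d - w)) * S             ≡⟨ cong (_* S) (sub-telescope p w d) ⟩
      (d - p) * S                         ∎
      where
      first-step : (w - p) * Φ w ≡ (w - p) * S
      first-step with w ≤? c
      ... | yes w≤c = trans (equal-sub-* (Φ w) w≡p) (sym (equal-sub-* S w≡p))
        where w≡p = ≤-antisym (≤-trans w≤c c≤p) p≤w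
      ... | no  w≰c = cong ((w - p) *_) (within w w≰c w≤d)
      advance : d ∈ (w ∷ W) ⊎ p ≡ d → d ∈ W ⊎ w ≡ d
      advance (inj₁ (here d≡w))  = inj₂ (sym d≡w)
      advance (inj₁ (there d∈W)) = inj₁ d∈W
      advance (inj₂ p≡d)         = inj₂ (≤-antisym w≤d (subst (_≤ w) p≡d p≤w))
      rest : thresholdSum Φ w W ≡ (d - w) * S
      rest = sum-from w W (≤-trans c≤p p≤w) w≤d asc w≤W (advance reach)
    ... | no w≰d = trans (sum-above p (w ∷ W) (w≰d ∷ All.map (λ w≤x x≤d → w≰d (≤-trans w≤x x≤d)) w≤W))
                         (sym (equal-sub-* S (sym (start-at-d reach))))
      where
      start-at-d : d ∈ (w ∷ W) ⊎ p ≡ d → p ≡ d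
      start-at-d (inj₁ d∈)  = ⊥-elim (w≰d (head-least (w≤W ∷ asc) d∈))
      start-at-d (inj₂ p≡d) = p≡d

    sum-box : ∀ p W → Ascending W → c ∈ W → d ∈ W → thresholdSum Φ p W ≡ (d - c) * S
    sum-box p (w ∷ W) (w≤W ∷ asc) c∈ d∈ =
      trans (cong₂ _+_ (trans (cong ((w - p) *_) (below w w≤c)) (zeroʳ _)) (rest c∈ d∈)) (+-identityˡ _)
      where
      w≤c : w ≤ c
      w≤c = head-least (w≤W ∷ asc) c∈
      from-c : w ≡ c → d ∈ W ⊎ w ≡ d → thresholdSum Φ w W ≡ (d - c) * S
      from-c refl = sum-from w W ≤-refl c≤d asc w≤W
      rest : c ∈ (w ∷ W) → d ∈ (w ∷ W) → thresholdSum Φ w W ≡ (d - c) * S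
      rest (here c≡w)  (here d≡w)  = from-c (sym c≡w) (inj₂ (sym d≡w))
      rest (here c≡w)  (there d∈W) = from-c (sym c≡w) (inj₁ d∈W)
      rest (there c∈W) (here d≡w)  = sum-box w W asc c∈W (subst (_∈ W) c≡d c∈W)
        where c≡d = ≤-antisym c≤d (subst (_≤ c) (sym d≡w) w≤c)
      rest (there c∈W) (there d∈W) = sum-box w W asc c∈W d∈W

module DecidableFacts where

  does-cong : ∀ {P Q : Set} (P? : Dec P) (Q? : Dec Q) → (P → Q) → (Q → P) → does P? ≡ does Q?
  does-cong (yes _) (yes _) _   _   = refl
  does-cong (no  _) (no  _) _   _   = refl
  does-cong (yes p) (no ¬q) p→q _   = ⊥-elim (¬q (p→q p))
  does-cong (no ¬p) (yes q) _   q→p = ⊥-elim (¬p (q→p q))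

  does-reflects : ∀ {P : Set} {b : Bool} (P? : Dec P) → (b ≡ true → P) → (P → b ≡ true) → b ≡ does P?
  does-reflects (yes p) _       P→b = P→b p
  does-reflects {b = true}  (no ¬p) b→P _ = ⊥-elim (¬p (b→P refl))
  does-reflects {b = false} (no ¬p) _   _ = refl

module SubsetLookup where

  subset-ext : ∀ {m} {p q : Subset m} → (∀ j → Vec.lookup p j ≡ Vec.lookup q j) → p ≡ q
  subset-ext {p = p} {q} p≗q =
    trans (sym (VecP.tabulate∘lookup p)) (trans (VecP.tabulate-cong p≗q) (VecP.tabulate∘lookup q))

  lookup-⊥ : ∀ {m} (j : Fin m) → Vec.lookup Sub.⊥ j ≡ false
  lookup-⊥ j = VecP.lookup-replicate j false

  lookup-⊤ : ∀ {m} (j : Fin m) → Vec.lookup Sub.⊤ j ≡ true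
  lookup-⊤ j = VecP.lookup-replicate j true

  lookup-∪ : ∀ {m} (p q : Subset m) j → Vec.lookup (p ∪ q) j ≡ Vec.lookup p j ∨ Vec.lookup q j
  lookup-∪ p q j = VecP.lookup-zipWith _∨_ j p q

  lookup-─ : ∀ {m} (p q : Subset m) j → Vec.lookup (p ─ q) j ≡ Vec.lookup p j ∧ not (Vec.lookup q j)
  lookup-─ (x ∷ p) (true  ∷ q) Fin.zero    = sym (BoolP.∧-zeroʳ x)
  lookup-─ (x ∷ p) (false ∷ q) Fin.zero    = sym (BoolP.∧-identityʳ x)
  lookup-─ (x ∷ p) (y     ∷ q) (Fin.suc j) = lookup-─ p q j

  lookup-⁅⁆-self : ∀ {m} (x : Fin m) → Vec.lookup ⁅ x ⁆ x ≡ true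
  lookup-⁅⁆-self x = VecP.[]=⇒lookup (SubP.x∈⁅x⁆ x)

  lookup-⁅⁆ : ∀ {m} (x j : Fin m) → Vec.lookup ⁅ x ⁆ j ≡ true → j ≡ x
  lookup-⁅⁆ x j h = SubP.x∈⁅y⁆⇒x≡y x (VecP.lookup⇒[]= j ⁅ x ⁆ h)

  false≢true : false ≢ true
  false≢true ()

  ∨-true : ∀ {a b} → a ∨ b ≡ true → a ≡ true ⊎ b ≡ true
  ∨-true {true}  _ = inj₁ refl
  ∨-true {false} h = inj₂ h

module UpperSets (R : RealField) {n : ℕ} where
  open RealField R
  open SubsetLookup

  upperSet : Act R n → Carrier → Subset n
  upperSet g w = Vec.tabulate (λ j → does (w ≤? g j))

  lookup-upperSet : ∀ g w j → Vec.lookup (upperSet g w) j ≡ does (w ≤? g j)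
  lookup-upperSet g w j = VecP.lookup∘tabulate _ j

  upperSet-≡ : ∀ g w (A : Subset n) → (∀ j → does (w ≤? g j) ≡ Vec.lookup A j) → upperSet g w ≡ A
  upperSet-≡ g w A same = subset-ext λ j → trans (lookup-upperSet g w j) (same j)

module LevelSets (R : RealField) {n : ℕ} (μ : Capacity R n) where
  open RealField R
  open FieldFacts R
  open SortedValues R
  open ThresholdSums R
  open DecidableFacts
  open SubsetLookup
  open UpperSets R
  open ≡-Reasoning

  levelSum : Act R n → Carrier → List Carrier → Carrier
  levelSum g = thresholdSum (λ w → μ (upperSet g w))

  values : Act R n → List Carrier
  values g = List.map g (List.allFin n)

  map-insert : ∀ (f : Act R n) x L → List.map f (insert R f x L) ≡ insertValue (f x) (List.map f L)
  map-insert f x []      = refl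
  map-insert f x (y ∷ L) with does (f x ≤? f y)
  ... | true  = refl
  ... | false = cong (f y ∷_) (map-insert f x L)

  map-sortBy : ∀ (f : Act R n) L → List.map f (sortBy R f L) ≡ sortValues (List.map f L)
  map-sortBy f []      = refl
  map-sortBy f (x ∷ L) = trans (map-insert f x (sortBy R f L)) (cong (insertValue (f x)) (map-sortBy f L))

  insertBy-↭ : ∀ (f : Act R n) x L → insert R f x L ↭ x ∷ L
  insertBy-↭ f x []      = Perm.refl
  insertBy-↭ f x (y ∷ L) with does (f x ≤? f y)
  ... | true  = Perm.refl
  ... | false = Perm.trans (Perm.prep y (insertBy-↭ f x L)) (Perm.swap y x Perm.refl)

  sortBy-↭ : ∀ (f : Act R n) L → sortBy R f L ↭ L
  sortBy-↭ f []      = Perm.refl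
  sortBy-↭ f (x ∷ L) = Perm.trans (insertBy-↭ f x (sortBy R f L)) (Perm.prep x (sortBy-↭ f L))

  toSubset-∈ : ∀ (L : List (Fin n)) j → Vec.lookup (toSubset R L) j ≡ true → j ∈ L
  toSubset-∈ [] j h = ⊥-elim (false≢true (trans (sym (lookup-⊥ j)) h))
  toSubset-∈ (x ∷ L) j h with ∨-true (trans (sym (lookup-∪ ⁅ x ⁆ (toSubset R L) j)) h)
  ... | inj₁ j∈⁅x⁆ = here (lookup-⁅⁆ x j j∈⁅x⁆)
  ... | inj₂ j∈L   = there (toSubset-∈ L j j∈L)

  ∈-toSubset : ∀ (L : List (Fin n)) j → j ∈ L → Vec.lookup (toSubset R L) j ≡ true
  ∈-toSubset (x ∷ L) j (here refl) =
    trans (lookup-∪ ⁅ x ⁆ (toSubset R L) x) (cong (_∨ Vec.lookup (toSubset R L) x) (lookup-⁅⁆-self x))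
  ∈-toSubset (x ∷ L) j (there j∈L) =
    trans (lookup-∪ ⁅ x ⁆ (toSubset R L) j) (trans (cong (Vec.lookup ⁅ x ⁆ j ∨_) (∈-toSubset L j j∈L)) (BoolP.∨-zeroʳ _))

  toSubset-upperSet : ∀ (f : Act R n) x xs → Ascending (List.map f (x ∷ xs)) →
                      (∀ j → f x ≤ f j → j ∈ x ∷ xs) → toSubset R (x ∷ xs) ≡ upperSet f (f x)
  toSubset-upperSet f x xs asc full = subset-ext λ j →
    trans (does-reflects (f x ≤? f j) (λ h → head-least asc (∈-map⁺ f (toSubset-∈ (x ∷ xs) j h)))
                                      (λ le → ∈-toSubset (x ∷ xs) j (full j le)))
          (sym (lookup-upperSet f (f x) j))

  cover-tail : ∀ (f : Act R n) x xs {p} → p ≤ f x → (∀ j → ¬ (f j ≤ p) → j ∈ x ∷ xs) →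
               ∀ j → ¬ (f j ≤ f x) → j ∈ xs
  cover-tail f x xs p≤fx cover j fj≰fx with cover j (λ fj≤p → fj≰fx (≤-trans fj≤p p≤fx))
  ... | here refl = ⊥-elim (fj≰fx ≤-refl)
  ... | there j∈xs = j∈xs

  choquetAux-above : ∀ (f : Act R n) p L → Ascending (List.map f L) → All (p ≤_) (List.map f L) →
                     (∀ j → ¬ (f j ≤ p) → j ∈ L) →
                     choquetAux R μ f p L ≡ levelSum f p (List.map f L)
  choquetAux-above f p []       _              _         _     = refl
  choquetAux-above f p (x ∷ xs) asc@(fx≤ ∷ asc′) (p≤fx ∷ _) cover =
    cong₂ _+_ first-term (choquetAux-above f (f x) xs asc′ fx≤ (cover-tail f x xs p≤fx cover))
    where
    first-term : (f x - p) * μ (toSubset R (x ∷ xs)) ≡ (f x - p) * μ (upperSet f (f x))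
    first-term with f x ≤? p
    ... | yes fx≤p = trans (equal-sub-* _ fx≡p) (sym (equal-sub-* _ fx≡p))
      where fx≡p = ≤-antisym fx≤p p≤fx
    ... | no  fx≰p = cong (λ A → (f x - p) * μ A) (toSubset-upperSet f x xs asc
                       (λ j fx≤fj → cover j (λ fj≤p → fx≰p (≤-trans fx≤fj fj≤p))))

  choquetAux-full : ∀ (f : Act R n) q L → Ascending (List.map f L) → (∀ j → j ∈ L) →
                    choquetAux R μ f q L ≡ levelSum f q (List.map f L)
  choquetAux-full f q []       _                   _   = refl
  choquetAux-full f q (x ∷ xs) asc@(fx≤ ∷ asc′) all∈ =
    cong₂ _+_ (cong (λ A → (f x - q) * μ A) (toSubset-upperSet f x xs asc (λ j _ → all∈ j)))
              (choquetAux-above f (f x) xs asc′ fx≤ (cover-tail f x xs ≤-refl (λ j _ → all∈ j)))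

  choquet-levelSum : ∀ (f : Act R n) → Choquet R μ f ≡ levelSum f 0ℝ (sortValues (values f))
  choquet-levelSum f = begin
    choquetAux R μ f 0ℝ sorted                ≡⟨ choquetAux-full f 0ℝ sorted asc all∈ ⟩
    levelSum f 0ℝ (List.map f sorted)         ≡⟨ cong (levelSum f 0ℝ) (map-sortBy f (List.allFin n)) ⟩
    levelSum f 0ℝ (sortValues (values f))     ∎
    where
    sorted = sortBy R f (List.allFin n)
    asc : Ascending (List.map f sorted)
    asc = subst Ascending (sym (map-sortBy f (List.allFin n))) (sort-ascending (values f))
    all∈ : ∀ j → j ∈ sorted
    all∈ j = ∈-resp-↭ (↭-sym (sortBy-↭ f (List.allFin n))) (∈-allFin j)

  -- When μ(∅) = 0, extra thresholds do not change a level sum: inserting w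
  -- either adds a zero term (no value of g is ≥ w) or splits a step whose
  -- level set does not change.
  module _ (μ∅ : μ Sub.⊥ ≡ 0ℝ) where

    levelSum-insert : ∀ g q w T → Ascending T → (∀ j → w ≤ g j → g j ∈ T) →
                      levelSum g q (insertValue w T) ≡ levelSum g q T
    levelSum-insert g q w [] _ covered = begin
      (w - q) * μ (upperSet g w) + 0ℝ  ≡⟨ cong (λ A → (w - q) * μ A + 0ℝ) empty ⟩
      (w - q) * μ Sub.⊥ + 0ℝ           ≡⟨ cong (λ m → (w - q) * m + 0ℝ) μ∅ ⟩
      (w - q) * 0ℝ + 0ℝ                ≡⟨ cong (_+ 0ℝ) (zeroʳ (w - q)) ⟩
      0ℝ + 0ℝ                          ≡⟨ +-identityˡ 0ℝ ⟩
      0ℝ                               ∎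
      where
      empty : upperSet g w ≡ Sub.⊥
      empty = subset-ext λ j → trans (lookup-upperSet g w j)
                (trans (dec-false (w ≤? g j) (λ w≤gj → ¬Any[] (covered j w≤gj))) (sym (lookup-⊥ j)))
    levelSum-insert g q w (t ∷ T) asc@(_ ∷ asc′) covered with w ≤? t
    ... | yes w≤t = begin
      (w - q) * μ (upperSet g w) + ((t - w) * μt + rest)
        ≡⟨ cong (λ A → (w - q) * μ A + ((t - w) * μt + rest)) same-level ⟩
      (w - q) * μt + ((t - w) * μt + rest)
        ≡⟨ +-assoc ((w - q) * μt) ((t - w) * μt) rest ⟨
      ((w - q) * μt + (t - w) * μt) + rest
        ≡⟨ cong (_+ rest) (distribʳ μt (w - q) (t - w)) ⟨
      ((w - q) + (t - w)) * μt + rest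
        ≡⟨ cong (λ x → x * μt + rest) (sub-telescope q w t) ⟩
      (t - q) * μt + rest ∎
      where
      μt = μ (upperSet g t)
      rest = levelSum g t T
      same-level : upperSet g w ≡ upperSet g t
      same-level = subset-ext λ j → trans (lookup-upperSet g w j)
        (trans (does-cong (w ≤? g j) (t ≤? g j) (λ w≤gj → head-least asc (covered j w≤gj)) (≤-trans w≤t))
               (sym (lookup-upperSet g t j)))
    ... | no w≰t = cong ((t - q) * μ (upperSet g t) +_) (levelSum-insert g t w T asc′ covered′)
      where
      covered′ : ∀ j → w ≤ g j → g j ∈ T
      covered′ j w≤gj with covered j w≤gj
      ... | here gj≡t   = ⊥-elim (w≰t (subst (w ≤_) gj≡t w≤gj))
      ... | there gj∈T  = gj∈T

    levelSum-insertAll : ∀ g q ws T → Ascending T → (∀ j → g j ∈ T) →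
                         levelSum g q (insertAll ws T) ≡ levelSum g q T
    levelSum-insertAll g q []       T asc all∈ = refl
    levelSum-insertAll g q (w ∷ ws) T asc all∈ =
      trans (levelSum-insert g q w (insertAll ws T) (insertAll-ascending ws asc)
                             (λ j _ → ∈-insertAll ws T (all∈ j)))
            (levelSum-insertAll g q ws T asc all∈)

    choquet-thresholds : ∀ g L → (∀ j → g j ∈ L) → Choquet R μ g ≡ levelSum g 0ℝ (sortValues L)
    choquet-thresholds g L all∈ = begin
      Choquet R μ g                                  ≡⟨ choquet-levelSum g ⟩
      levelSum g 0ℝ (sortValues V)                   ≡⟨ levelSum-insertAll g 0ℝ L (sortValues V) (sort-ascending V) all∈V ⟨
      levelSum g 0ℝ (insertAll L (sortValues V))     ≡⟨ cong (levelSum g 0ℝ) (sort-++ L V) ⟨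
      levelSum g 0ℝ (sortValues (L ++ V))            ≡⟨ cong (levelSum g 0ℝ) (sort-perm-invariant (++-comm L V)) ⟩
      levelSum g 0ℝ (sortValues (V ++ L))            ≡⟨ cong (levelSum g 0ℝ) (sort-++ V L) ⟩
      levelSum g 0ℝ (insertAll V (sortValues L))     ≡⟨ levelSum-insertAll g 0ℝ V (sortValues L) (sort-ascending L) (λ j → ∈-sort L (all∈ j)) ⟩
      levelSum g 0ℝ (sortValues L)                   ∎
      where
      V = values g
      all∈V : ∀ j → g j ∈ sortValues V
      all∈V j = ∈-sort V (∈-map⁺ g (∈-allFin j))

module Shifts (R : RealField) {n : ℕ} where
  open RealField R
  open FieldFacts R
  open DecidableFacts
  open SubsetLookup
  open UpperSets R {n}

  Gap : Act R n → Carrier → Carrier → Set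
  Gap f c t = ∀ j → f j ≤ c ⊎ c + t ≤ f j

  module _ (f : Act R n) {c t : Carrier} (0<t : 0ℝ < t) (B : Subset n)
           (const : ∀ j → Vec.lookup B j ≡ true → f j ≡ c) where

    private
      f^B = shift R f t B
      c≤c+t = x≤x+t c (proj₁ 0<t)

    data ShiftView (j : Fin n) : Set where
      moved : Vec.lookup B j ≡ true  → f j ≡ c → f^B j ≡ c + t → ShiftView j
      kept  : Vec.lookup B j ≡ false → f^B j ≡ f j → ShiftView j

    shiftView : ∀ j → ShiftView j
    shiftView j with Vec.lookup B j in j∈B
    ... | true  = moved j∈B (const j j∈B)
                        (trans (cong (λ b → if b then f j + t else f j) j∈B) (cong (_+ t) (const j j∈B)))
    ... | false = kept j∈B (cong (λ b → if b then f j + t else f j) j∈B)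

    upperSet-below : ∀ w → w ≤ c → upperSet f^B w ≡ upperSet f w
    upperSet-below w w≤c = upperSet-≡ f^B w (upperSet f w) λ j →
      trans (same j (shiftView j)) (sym (lookup-upperSet f w j))
      where
      same : ∀ j → ShiftView j → does (w ≤? f^B j) ≡ does (w ≤? f j)
      same j (moved _ fj≡c f^Bj≡) = does-cong (w ≤? f^B j) (w ≤? f j)
        (λ _ → subst (w ≤_) (sym fj≡c) w≤c) (λ _ → subst (w ≤_) (sym f^Bj≡) (≤-trans w≤c c≤c+t))
      same j (kept _ f^Bj≡) = cong (λ v → does (w ≤? v)) f^Bj≡

    upperSet-above : ∀ w → ¬ (w ≤ c + t) → upperSet f^B w ≡ upperSet f w
    upperSet-above w w≰c+t = upperSet-≡ f^B w (upperSet f w) λ j →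
      trans (same j (shiftView j)) (sym (lookup-upperSet f w j))
      where
      same : ∀ j → ShiftView j → does (w ≤? f^B j) ≡ does (w ≤? f j)
      same j (moved _ fj≡c f^Bj≡) = does-cong (w ≤? f^B j) (w ≤? f j)
        (λ w≤ → ⊥-elim (w≰c+t (subst (w ≤_) f^Bj≡ w≤)))
        (λ w≤ → ⊥-elim (w≰c+t (≤-trans (subst (w ≤_) fj≡c w≤) c≤c+t)))
      same j (kept _ f^Bj≡) = cong (λ v → does (w ≤? v)) f^Bj≡

    upperSet-inside : Gap f c t → ∀ w → ¬ (w ≤ c) → w ≤ c + t →
                      upperSet f^B w ≡ upperSet f (c + t) ∪ B
    upperSet-inside gap w w≰c w≤c+t = upperSet-≡ f^B w (upperSet f (c + t) ∪ B) λ j →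
      trans (same j (shiftView j)) (sym (lookup-∪ (upperSet f (c + t)) B j))
      where
      same : ∀ j → ShiftView j → does (w ≤? f^B j) ≡ Vec.lookup (upperSet f (c + t)) j ∨ Vec.lookup B j
      same j (moved j∈B _ f^Bj≡) =
        trans (dec-true (w ≤? f^B j) (subst (w ≤_) (sym f^Bj≡) w≤c+t))
              (sym (trans (cong (_ ∨_) j∈B) (BoolP.∨-zeroʳ _)))
      same j (kept j∉B f^Bj≡) = begin
        does (w ≤? f^B j)          ≡⟨ cong (λ v → does (w ≤? v)) f^Bj≡ ⟩
        does (w ≤? f j)            ≡⟨ does-cong (w ≤? f j) ((c + t) ≤? f j) above-gap (≤-trans w≤c+t) ⟩
        does ((c + t) ≤? f j)        ≡⟨ lookup-upperSet f (c + t) j ⟨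
        Vec.lookup (upperSet f (c + t)) j            ≡⟨ BoolP.∨-identityʳ _ ⟨
        Vec.lookup (upperSet f (c + t)) j ∨ false    ≡⟨ cong (_ ∨_) j∉B ⟨
        Vec.lookup (upperSet f (c + t)) j ∨ Vec.lookup B j ∎
        where
        open ≡-Reasoning
        above-gap : w ≤ f j → c + t ≤ f j
        above-gap w≤fj with gap j
        ... | inj₁ fj≤c   = ⊥-elim (w≰c (≤-trans w≤fj fj≤c))
        ... | inj₂ c+t≤fj = c+t≤fj

    gap⇒comonotone : Gap f c t → Comonotone R f^B f
    gap⇒comonotone gap i j = compare (shiftView i) (shiftView j)
      where
      at : ∀ {a b a′ b′} → f^B i ≡ a → f^B j ≡ b → f i ≡ a′ → f j ≡ b′ →
           0ℝ ≤ (a - b) * (a′ - b′) → 0ℝ ≤ (f^B i - f^B j) * (f i - f j)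
      at refl refl refl refl h = h
      compare : ShiftView i → ShiftView j → 0ℝ ≤ (f^B i - f^B j) * (f i - f j)
      compare (kept _ f^Bi≡) (kept _ f^Bj≡) = at f^Bi≡ f^Bj≡ refl refl (square-nonneg _)
      compare (moved _ _ f^Bi≡) (moved _ _ f^Bj≡) =
        subst (0ℝ ≤_) (sym (equal-sub-* _ (trans f^Bi≡ (sym f^Bj≡)))) ≤-refl
      compare (moved _ fi≡c f^Bi≡) (kept _ f^Bj≡) with gap j
      ... | inj₁ fj≤c   = at f^Bi≡ f^Bj≡ fi≡c refl
                            (same-sign (inj₁ (sub-nonneg (≤-trans fj≤c c≤c+t) , sub-nonneg fj≤c)))
      ... | inj₂ c+t≤fj = at f^Bi≡ f^Bj≡ fi≡c refl
                            (same-sign (inj₂ (sub-nonpos c+t≤fj , sub-nonpos (≤-trans c≤c+t c+t≤fj))))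
      compare (kept _ f^Bi≡) (moved _ fj≡c f^Bj≡) with gap i
      ... | inj₁ fi≤c   = at f^Bi≡ f^Bj≡ refl fj≡c
                            (same-sign (inj₂ (sub-nonpos (≤-trans fi≤c c≤c+t) , sub-nonpos fi≤c)))
      ... | inj₂ c+t≤fi = at f^Bi≡ f^Bj≡ refl fj≡c
                            (same-sign (inj₁ (sub-nonneg c+t≤fi , sub-nonneg (≤-trans c≤c+t c+t≤fi))))

    -- a value strictly between c and c + t would make f^B and f disagree in
    -- direction between that coordinate and a moved one
    comonotone⇒gap : ∀ j₀ → Vec.lookup B j₀ ≡ true → Comonotone R f^B f → Gap f c t
    comonotone⇒gap j₀ j₀∈B comonotone j with f j ≤? c | (c + t) ≤? f j
    ... | yes fj≤c | _           = inj₁ fj≤c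
    ... | no  _    | yes c+t≤fj  = inj₂ c+t≤fj
    ... | no  fj≰c | no  c+t≰fj  with shiftView j₀ | shiftView j
    ...   | moved _ fj₀≡c f^Bj₀≡ | kept _ f^Bj≡ =
            ⊥-elim (pos-*-neg (sub-pos (≰⇒> c+t≰fj)) (sub-neg (≰⇒> fj≰c))
                     (subst (0ℝ ≤_) (trans (cong₂ (λ a b → (a - f^B j) * (b - f j)) f^Bj₀≡ fj₀≡c)
                                           (cong (λ a → ((c + t) - a) * (c - f j)) f^Bj≡))
                            (comonotone j₀ j)))
    ...   | kept j₀∉B _ | _ = ⊥-elim (false≢true (trans (sym j₀∉B) j₀∈B))
    ...   | moved _ _ _ | moved _ fj≡c _ = ⊥-elim (fj≰c (≤-reflexive fj≡c))

module Images (R : RealField) {k n : ℕ} (ι : Fin k → Fin n) where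
  open SubsetLookup

  private
    imageOver : Subset k → List (Fin k) → Subset n
    imageOver b = List.foldr (λ a s → if Vec.lookup b a then ⁅ ι a ⁆ ∪ s else s) Sub.⊥

    imageOver-∈ : ∀ b L j → Vec.lookup (imageOver b L) j ≡ true → ∃ λ a → Vec.lookup b a ≡ true × ι a ≡ j
    imageOver-∈ b [] j h = ⊥-elim (false≢true (trans (sym (lookup-⊥ j)) h))
    imageOver-∈ b (a ∷ L) j h with Vec.lookup b a in a∈b
    ... | false = imageOver-∈ b L j h
    ... | true with ∨-true (trans (sym (lookup-∪ ⁅ ι a ⁆ (imageOver b L) j)) h)
    ...   | inj₁ j∈⁅ιa⁆ = a , a∈b , sym (lookup-⁅⁆ (ι a) j j∈⁅ιa⁆)
    ...   | inj₂ j∈rest = imageOver-∈ b L j j∈rest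

    ∈-imageOver : ∀ b L a → a ∈ L → Vec.lookup b a ≡ true → Vec.lookup (imageOver b L) (ι a) ≡ true
    ∈-imageOver b (a′ ∷ L) a a∈L a∈b with Vec.lookup b a′ in a′∈b
    ∈-imageOver b (a′ ∷ L) a (here refl)  a∈b | false = ⊥-elim (false≢true (trans (sym a′∈b) a∈b))
    ∈-imageOver b (a′ ∷ L) a (there a∈L) a∈b | false = ∈-imageOver b L a a∈L a∈b
    ∈-imageOver b (a′ ∷ L) a (here refl)  a∈b | true  =
      trans (lookup-∪ ⁅ ι a ⁆ _ (ι a)) (cong (_∨ Vec.lookup (imageOver b L) (ι a)) (lookup-⁅⁆-self (ι a)))
    ∈-imageOver b (a′ ∷ L) a (there a∈L) a∈b | true  =
      trans (lookup-∪ ⁅ ι a′ ⁆ _ (ι a))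
            (trans (cong (Vec.lookup ⁅ ι a′ ⁆ (ι a) ∨_) (∈-imageOver b L a a∈L a∈b)) (BoolP.∨-zeroʳ _))

  image-∈ : ∀ b j → Vec.lookup (image R ι b) j ≡ true → ∃ λ a → Vec.lookup b a ≡ true × ι a ≡ j
  image-∈ b = imageOver-∈ b (List.allFin k)

  ∈-image : ∀ b a → Vec.lookup b a ≡ true → Vec.lookup (image R ι b) (ι a) ≡ true
  ∈-image b a = ∈-imageOver b (List.allFin k) a (∈-allFin a)

  data DirectionView (j : Fin n) : Set where
    direction : ∀ a → ι a ≡ j → DirectionView j
    other     : (∀ b → Vec.lookup (image R ι b) j ≡ false) → DirectionView j

  directionView : ∀ j → DirectionView j
  directionView j with Vec.lookup (image R ι Sub.⊤) j in j∈ι⊤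
  ... | true  = let (a , _ , ιa≡j) = image-∈ Sub.⊤ j j∈ι⊤ in direction a ιa≡j
  ... | false = other λ b → BoolP.¬-not λ j∈ιb →
                  let (a , _ , ιa≡j) = image-∈ b j j∈ιb in
                  false≢true (trans (sym j∈ι⊤) (subst (λ i → Vec.lookup (image R ι Sub.⊤) i ≡ true) ιa≡j
                                                      (∈-image Sub.⊤ a (lookup-⊤ a))))

  lookup-image : Injective _≡_ _≡_ ι → ∀ b a → Vec.lookup (image R ι b) (ι a) ≡ Vec.lookup b a
  lookup-image inj b a with Vec.lookup b a in a∈b
  ... | true  = ∈-image b a a∈b
  ... | false = BoolP.¬-not λ ιa∈ιb →
                  let (a′ , a′∈b , ιa′≡ιa) = image-∈ b (ι a) ιa∈ιb in
                  false≢true (trans (sym a∈b) (subst (λ x → Vec.lookup b x ≡ true) (inj ιa′≡ιa) a′∈b))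

-- If f is constant (= c) on the directions and (c, c + t) is a gap of f, then
--   Σ_b (-1)^|b| C_μ(f^{ι(b)}) = t · Δ({c + t ≤ f}):
-- by the level-set description of f^{ι(b)}, the alternating sum of the
-- capacities of upper level sets is 0 outside (c, c + t] and Δ({c + t ≤ f})
-- inside it.
module AlternatingShifts (R : RealField) {n : ℕ} (μ : Capacity R n) (μ∅ : μ Sub.⊥ ≡ RealField.0ℝ R)
                         {k : ℕ} (ι : Fin (suc k) → Fin n) where
  open RealField R
  open FieldFacts R
  open SubsetSums R
  open SortedValues R
  open ThresholdSums R
  open UpperSets R {n}
  open LevelSets R μ
  open Shifts R {n}
  open Images R ι
  open ≡-Reasoning

  sign : Subset (suc k) → Carrier
  sign b = negOnePow R ∣ b ∣

  Δ : Subset n → Carrier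
  Δ X = sumSubsets R (suc k) (λ b → sign b * μ (X ∪ image R ι b))

  alternating-shift : ∀ (f : Act R n) c t → 0ℝ < t → (∀ a → f (ι a) ≡ c) → Gap f c t →
    sumSubsets R (suc k) (λ b → sign b * Choquet R μ (shift R f t (image R ι b)))
      ≡ t * Δ (upperSet f (c + t))
  alternating-shift f c t 0<t const gap = begin
    sumSubsets R (suc k) (λ b → sign b * Choquet R μ (f^ b))
      ≡⟨ sum-cong (suc k) (λ b → cong (sign b *_) (choquet-thresholds μ∅ (f^ b) L (values-in-L b))) ⟩
    sumSubsets R (suc k) (λ b → sign b * levelSum (f^ b) 0ℝ W)
      ≡⟨ thresholdSum-linear (suc k) sign (λ b w → μ (upperSet (f^ b) w)) 0ℝ W ⟩
    thresholdSum Φ 0ℝ W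
      ≡⟨ Box.sum-box Φ (Δ A) c≤c+t below above within 0ℝ W (sort-ascending L) c∈W c+t∈W ⟩
    ((c + t) - c) * Δ A
      ≡⟨ cong (_* Δ A) (add-sub-cancelˡ c t) ⟩
    t * Δ A ∎
    where
    f^ : Subset (suc k) → Act R n
    f^ b = shift R f t (image R ι b)
    A = upperSet f (c + t)
    c≤c+t = x≤x+t c (proj₁ 0<t)
    const-on : ∀ b j → Vec.lookup (image R ι b) j ≡ true → f j ≡ c
    const-on b j j∈ιb = let (a , _ , ιa≡j) = image-∈ b j j∈ιb in trans (cong f (sym ιa≡j)) (const a)
    L = (c + t) ∷ values f
    W = sortValues L
    values-in-L : ∀ b j → f^ b j ∈ L
    values-in-L b j with shiftView f 0<t (image R ι b) (const-on b) j
    ... | moved _ _ f^bj≡ = here f^bj≡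
    ... | kept _ f^bj≡    = there (subst (_∈ values f) (sym f^bj≡) (∈-map⁺ f (∈-allFin j)))
    c∈W : c ∈ W
    c∈W = ∈-sort L (there (subst (_∈ values f) (const Fin.zero) (∈-map⁺ f (∈-allFin (ι Fin.zero)))))
    c+t∈W : (c + t) ∈ W
    c+t∈W = ∈-sort L (here refl)
    Φ : Carrier → Carrier
    Φ w = sumSubsets R (suc k) (λ b → sign b * μ (upperSet (f^ b) w))
    unshifted : ∀ w → (∀ b → upperSet (f^ b) w ≡ upperSet f w) → Φ w ≡ 0ℝ
    unshifted w same = trans (sum-cong (suc k) (λ b → cong (λ S → sign b * μ S) (same b)))
                             (alternating-const k (μ (upperSet f w)))
    below : ∀ w → w ≤ c → Φ w ≡ 0ℝ
    below w w≤c = unshifted w (λ b → upperSet-below f 0<t (image R ι b) (const-on b) w w≤c)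
    above : ∀ w → ¬ (w ≤ c + t) → Φ w ≡ 0ℝ
    above w w≰ = unshifted w (λ b → upperSet-above f 0<t (image R ι b) (const-on b) w w≰)
    within : ∀ w → ¬ (w ≤ c) → w ≤ c + t → Φ w ≡ Δ A
    within w w≰c w≤ = sum-cong (suc k) λ b →
      cong (λ S → sign b * μ S) (upperSet-inside f 0<t (image R ι b) (const-on b) gap w w≰c w≤)

  Flat : Set
  Flat = ∀ X → (∀ a → Vec.lookup X (ι a) ≡ false) → Δ X ≡ Δ Sub.⊥

  A9At : Set
  A9At = ∀ f g → (∀ a b → f (ι a) ≡ f (ι b)) → (∀ a b → g (ι a) ≡ g (ι b)) →
    ∀ t → 0ℝ < t →
    (∀ b → Comonotone R (shift R f t (image R ι b)) f × Comonotone R (shift R g t (image R ι b)) g) →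
    sumSubsets R (suc k) (λ b → negOnePow R ∣ b ∣ * Choquet R μ (shift R f t (image R ι b)))
      ≡ sumSubsets R (suc k) (λ b → negOnePow R ∣ b ∣ * Choquet R μ (shift R g t (image R ι b)))

  ι₀∈ι⊤ : Vec.lookup (image R ι Sub.⊤) (ι Fin.zero) ≡ true
  ι₀∈ι⊤ = ∈-image Sub.⊤ Fin.zero (SubsetLookup.lookup-⊤ {suc k} Fin.zero)

  -- under A9's hypotheses the alternating sum is t·Δ(∅) when Δ is flat:
  -- comonotonicity forces a gap, and {c + t ≤ f} avoids the directions
  flat-shift-sum : Flat → ∀ (f : Act R n) t → 0ℝ < t → (∀ a b → f (ι a) ≡ f (ι b)) →
    Comonotone R (shift R f t (image R ι Sub.⊤)) f →
    sumSubsets R (suc k) (λ b → sign b * Choquet R μ (shift R f t (image R ι b))) ≡ t * Δ Sub.⊥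
  flat-shift-sum flat f t 0<t f-const comonotone = begin
    sumSubsets R (suc k) (λ b → sign b * Choquet R μ (shift R f t (image R ι b)))
      ≡⟨ alternating-shift f c t 0<t const gap ⟩
    t * Δ (upperSet f (c + t))   ≡⟨ cong (t *_) (flat (upperSet f (c + t)) avoids) ⟩
    t * Δ Sub.⊥                  ∎
    where
    c = f (ι Fin.zero)
    const : ∀ a → f (ι a) ≡ c
    const a = f-const a Fin.zero
    const-on : ∀ j → Vec.lookup (image R ι Sub.⊤) j ≡ true → f j ≡ c
    const-on j j∈ι⊤ = let (a , _ , ιa≡j) = image-∈ Sub.⊤ j j∈ι⊤ in trans (cong f (sym ιa≡j)) (const a)
    gap : Gap f c t
    gap = comonotone⇒gap f 0<t (image R ι Sub.⊤) const-on (ι Fin.zero) ι₀∈ι⊤ comonotone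
    avoids : ∀ a → Vec.lookup (upperSet f (c + t)) (ι a) ≡ false
    avoids a = trans (lookup-upperSet f (c + t) (ι a))
                     (dec-false ((c + t) ≤? f (ι a)) (λ c+t≤ → x+t≰x c 0<t (subst ((c + t) ≤_) (const a) c+t≤)))

  flat⇒A9 : Flat → A9At
  flat⇒A9 flat f g f-const g-const t 0<t comonotone =
    trans (flat-shift-sum flat f t 0<t f-const (proj₁ (comonotone Sub.⊤)))
          (sym (flat-shift-sum flat g t 0<t g-const (proj₂ (comonotone Sub.⊤))))

  indicator : Subset n → Act R n
  indicator X j = if Vec.lookup X j then 1ℝ else 0ℝ

  module _ (X : Subset n) (avoids : ∀ a → Vec.lookup X (ι a) ≡ false) where

    indicator-const : ∀ a → indicator X (ι a) ≡ 0ℝ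
    indicator-const a = cong (λ x → if x then 1ℝ else 0ℝ) (avoids a)

    indicator-gap : Gap (indicator X) 0ℝ 1ℝ
    indicator-gap j with Vec.lookup X j
    ... | true  = inj₂ (≤-reflexive (+-identityˡ 1ℝ))
    ... | false = inj₁ ≤-refl

    upperSet-indicator : upperSet (indicator X) (0ℝ + 1ℝ) ≡ X
    upperSet-indicator = upperSet-≡ (indicator X) (0ℝ + 1ℝ) X λ j → level j
      where
      level : ∀ j → does ((0ℝ + 1ℝ) ≤? indicator X j) ≡ Vec.lookup X j
      level j with Vec.lookup X j
      ... | true  = dec-true  ((0ℝ + 1ℝ) ≤? 1ℝ) (≤-reflexive (+-identityˡ 1ℝ))
      ... | false = dec-false ((0ℝ + 1ℝ) ≤? 0ℝ) (x+t≰x 0ℝ 0<1)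

    indicator-shift-sum :
      sumSubsets R (suc k) (λ b → sign b * Choquet R μ (shift R (indicator X) 1ℝ (image R ι b))) ≡ Δ X
    indicator-shift-sum = begin
      sumSubsets R (suc k) (λ b → sign b * Choquet R μ (shift R (indicator X) 1ℝ (image R ι b)))
        ≡⟨ alternating-shift (indicator X) 0ℝ 1ℝ 0<1 indicator-const indicator-gap ⟩
      1ℝ * Δ (upperSet (indicator X) (0ℝ + 1ℝ))   ≡⟨ *-identityˡ _ ⟩
      Δ (upperSet (indicator X) (0ℝ + 1ℝ))        ≡⟨ cong Δ upperSet-indicator ⟩
      Δ X                                          ∎

    indicator-comonotone : ∀ b → Comonotone R (shift R (indicator X) 1ℝ (image R ι b)) (indicator X)
    indicator-comonotone b = gap⇒comonotone (indicator X) 0<1 (image R ι b) const-on indicator-gap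
      where
      const-on : ∀ j → Vec.lookup (image R ι b) j ≡ true → indicator X j ≡ 0ℝ
      const-on j j∈ιb = let (a , _ , ιa≡j) = image-∈ b j j∈ιb in
                        trans (cong (indicator X) (sym ιa≡j)) (indicator-const a)

  -- A9 applied to the indicators of X and of ∅ gives Δ(X) = Δ(∅)
  A9⇒flat : A9At → Flat
  A9⇒flat a9 X avoids = begin
    Δ X           ≡⟨ indicator-shift-sum X avoids ⟨
    _             ≡⟨ a9 (indicator X) (indicator Sub.⊥)
                        (λ a b → trans (indicator-const X avoids a) (sym (indicator-const X avoids b)))
                        (λ a b → trans (indicator-const Sub.⊥ ∅-avoids a) (sym (indicator-const Sub.⊥ ∅-avoids b)))
                        1ℝ 0<1
                        (λ b → indicator-comonotone X avoids b , indicator-comonotone Sub.⊥ ∅-avoids b) ⟩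
    _             ≡⟨ indicator-shift-sum Sub.⊥ ∅-avoids ⟩
    Δ Sub.⊥       ∎
    where
    ∅-avoids : ∀ a → Vec.lookup Sub.⊥ (ι a) ≡ false
    ∅-avoids a = SubsetLookup.lookup-⊥ (ι a)

  ConditionAt : Set
  ConditionAt = ∀ (C : Subset n) → (∀ a → ι a Sub.∈ C) →
    sumSubsets R (suc k) (λ b → negOnePow R ∣ b ∣ * μ (C ─ image R ι b))
      ≡ sumSubsets R (suc k) (λ b → negOnePow R (suc k ℕ.∸ ∣ b ∣) * μ (image R ι b))

  removed-avoids : ∀ C a → Vec.lookup (C ─ image R ι Sub.⊤) (ι a) ≡ false
  removed-avoids C a = trans (SubsetLookup.lookup-─ C (image R ι Sub.⊤) (ι a))
    (trans (cong (λ y → Vec.lookup C (ι a) ∧ not y) (∈-image Sub.⊤ a (SubsetLookup.lookup-⊤ a)))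
           (BoolP.∧-zeroʳ _))

  scaled-Δ : ∀ X → sumSubsets R (suc k) (λ b → (negOnePow R (suc k) * sign b) * μ (X ∪ image R ι b))
                     ≡ negOnePow R (suc k) * Δ X
  scaled-Δ X = trans (sum-cong (suc k) (λ b → *-assoc (negOnePow R (suc k)) (sign b) (μ (X ∪ image R ι b))))
                     (sum-* (suc k) (negOnePow R (suc k)) (λ b → sign b * μ (X ∪ image R ι b)))

  condition-rhs : sumSubsets R (suc k) (λ b → negOnePow R (suc k ℕ.∸ ∣ b ∣) * μ (image R ι b))
                    ≡ negOnePow R (suc k) * Δ Sub.⊥
  condition-rhs = trans (sum-cong (suc k) term) (scaled-Δ Sub.⊥)
    where
    term : ∀ b → negOnePow R (suc k ℕ.∸ ∣ b ∣) * μ (image R ι b)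
                   ≡ (negOnePow R (suc k) * sign b) * μ (Sub.⊥ ∪ image R ι b)
    term b = cong₂ _*_ (trans (cong (negOnePow R) (sym (SubP.∣∁p∣≡n∸∣p∣ b))) (negOnePow-∁ b))
                       (cong μ (sym (SubP.∪-identityˡ (image R ι b))))

  module _ (inj : Injective _≡_ _≡_ ι) where
    open SubsetLookup

    remove-complement : ∀ C → (∀ a → Vec.lookup C (ι a) ≡ true) → ∀ b →
                        C ─ image R ι (Sub.∁ b) ≡ (C ─ image R ι Sub.⊤) ∪ image R ι b
    remove-complement C ι⊆C b = subset-ext λ j → pointwise j (directionView j)
      where
      open ≡-Reasoning
      pointwise : ∀ j → DirectionView j →
        Vec.lookup (C ─ image R ι (Sub.∁ b)) j ≡ Vec.lookup ((C ─ image R ι Sub.⊤) ∪ image R ι b) j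
      pointwise j (direction a refl) = begin
        Vec.lookup (C ─ image R ι (Sub.∁ b)) (ι a)
          ≡⟨ lookup-─ C (image R ι (Sub.∁ b)) (ι a) ⟩
        Vec.lookup C (ι a) ∧ not (Vec.lookup (image R ι (Sub.∁ b)) (ι a))
          ≡⟨ cong₂ (λ x y → x ∧ not y) (ι⊆C a) (trans (lookup-image inj (Sub.∁ b) a) (VecP.lookup-map a not b)) ⟩
        not (not (Vec.lookup b a))
          ≡⟨ BoolP.not-involutive _ ⟩
        Vec.lookup b a
          ≡⟨ lookup-image inj b a ⟨
        false ∨ Vec.lookup (image R ι b) (ι a)
          ≡⟨ cong (_∨ Vec.lookup (image R ι b) (ι a)) (removed-avoids C a) ⟨
        Vec.lookup (C ─ image R ι Sub.⊤) (ι a) ∨ Vec.lookup (image R ι b) (ι a)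
          ≡⟨ lookup-∪ (C ─ image R ι Sub.⊤) (image R ι b) (ι a) ⟨
        Vec.lookup ((C ─ image R ι Sub.⊤) ∪ image R ι b) (ι a) ∎
      pointwise j (other away) = begin
        Vec.lookup (C ─ image R ι (Sub.∁ b)) j
          ≡⟨ trans (lookup-─ C (image R ι (Sub.∁ b)) j) (cong (λ y → Vec.lookup C j ∧ not y) (away (Sub.∁ b))) ⟩
        Vec.lookup C j ∧ true
          ≡⟨ BoolP.∨-identityʳ _ ⟨
        (Vec.lookup C j ∧ true) ∨ false
          ≡⟨ cong₂ _∨_ (trans (lookup-─ C (image R ι Sub.⊤) j) (cong (λ y → Vec.lookup C j ∧ not y) (away Sub.⊤))) (away b) ⟨
        Vec.lookup (C ─ image R ι Sub.⊤) j ∨ Vec.lookup (image R ι b) j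
          ≡⟨ lookup-∪ (C ─ image R ι Sub.⊤) (image R ι b) j ⟨
        Vec.lookup ((C ─ image R ι Sub.⊤) ∪ image R ι b) j ∎

    add-remove : ∀ X → (∀ a → Vec.lookup X (ι a) ≡ false) → (X ∪ image R ι Sub.⊤) ─ image R ι Sub.⊤ ≡ X
    add-remove X avoids = subset-ext λ j → pointwise j (directionView j)
      where
      pointwise : ∀ j → DirectionView j → Vec.lookup ((X ∪ image R ι Sub.⊤) ─ image R ι Sub.⊤) j ≡ Vec.lookup X j
      pointwise j (direction a refl) = trans (removed-avoids (X ∪ image R ι Sub.⊤) a) (sym (avoids a))
      pointwise j (other away) =
        trans (lookup-─ (X ∪ image R ι Sub.⊤) (image R ι Sub.⊤) j)
              (trans (cong₂ (λ x y → x ∧ not y) (trans (lookup-∪ X (image R ι Sub.⊤) j) (cong (Vec.lookup X j ∨_) (away Sub.⊤)))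
                                                 (away Sub.⊤))
                     (trans (BoolP.∧-identityʳ _) (BoolP.∨-identityʳ _)))

    condition-lhs : ∀ C → (∀ a → Vec.lookup C (ι a) ≡ true) →
                    sumSubsets R (suc k) (λ b → negOnePow R ∣ b ∣ * μ (C ─ image R ι b))
                      ≡ negOnePow R (suc k) * Δ (C ─ image R ι Sub.⊤)
    condition-lhs C ι⊆C = begin
      sumSubsets R (suc k) (λ b → sign b * μ (C ─ image R ι b))
        ≡⟨ sum-∁ (suc k) (λ b → sign b * μ (C ─ image R ι b)) ⟨
      sumSubsets R (suc k) (λ b → sign (Sub.∁ b) * μ (C ─ image R ι (Sub.∁ b)))
        ≡⟨ sum-cong (suc k) (λ b → cong₂ _*_ (negOnePow-∁ b) (cong μ (remove-complement C ι⊆C b))) ⟩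
      sumSubsets R (suc k) (λ b → (negOnePow R (suc k) * sign b) * μ ((C ─ image R ι Sub.⊤) ∪ image R ι b))
        ≡⟨ scaled-Δ (C ─ image R ι Sub.⊤) ⟩
      negOnePow R (suc k) * Δ (C ─ image R ι Sub.⊤) ∎

    flat⇒condition : Flat → ConditionAt
    flat⇒condition flat C ι∈C = begin
      _                                              ≡⟨ condition-lhs C (λ a → VecP.[]=⇒lookup (ι∈C a)) ⟩
      negOnePow R (suc k) * Δ (C ─ image R ι Sub.⊤) ≡⟨ cong (negOnePow R (suc k) *_) (flat _ (removed-avoids C)) ⟩
      negOnePow R (suc k) * Δ Sub.⊥                 ≡⟨ condition-rhs ⟨
      _                                              ∎

    condition⇒flat : ConditionAt → Flat
    condition⇒flat condition X avoids = negOnePow-cancel (suc k) (begin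
      negOnePow R (suc k) * Δ X                      ≡⟨ cong (λ Y → negOnePow R (suc k) * Δ Y) (add-remove X avoids) ⟨
      negOnePow R (suc k) * Δ (C ─ image R ι Sub.⊤) ≡⟨ condition-lhs C ι⊆C ⟨
      _                                              ≡⟨ condition C (λ a → VecP.lookup⇒[]= (ι a) C (ι⊆C a)) ⟩
      _                                              ≡⟨ condition-rhs ⟩
      negOnePow R (suc k) * Δ Sub.⊥                 ∎)
      where
      C = X ∪ image R ι Sub.⊤
      ι⊆C : ∀ a → Vec.lookup C (ι a) ≡ true
      ι⊆C a = trans (lookup-∪ X (image R ι Sub.⊤) (ι a))
                    (trans (cong (Vec.lookup X (ι a) ∨_) (∈-image Sub.⊤ a (lookup-⊤ a))) (BoolP.∨-zeroʳ _))

open import Data.Nat using (_≤_; s≤s; z≤n)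

-- Proposition 16.
proposition16 : (R : RealField) → (n k : ℕ) → 1 ≤ k → k ≤ n →
    (_≽_ : Pref R n) → A1 R _≽_ → A2 R _≽_ → A4 R _≽_ → A5 R _≽_ → A6 R _≽_ →
    (μ : Capacity R n) → IsCapacity R μ → Represents R (Choquet R μ) _≽_ →
    A9 R k (Choquet R μ) ⇔ CapacityCondition R k μ
proposition16 R n (suc k) (s≤s z≤n) _ _≽_ _ _ _ _ _ μ (μ∅ , _ , _) _ = mk⇔ A9⇒condition condition⇒A9
  where
  open AlternatingShifts R μ μ∅ {k}

  A9⇒condition : A9 R (suc k) (Choquet R μ) → CapacityCondition R (suc k) μ
  A9⇒condition a9 ι inj = flat⇒condition ι inj (A9⇒flat ι (a9 ι inj))

  condition⇒A9 : CapacityCondition R (suc k) μ → A9 R (suc k) (Choquet R μ)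
  condition⇒A9 condition ι inj = flat⇒A9 ι (condition⇒flat ι inj (condition ι inj))
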